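{- Let $f,g\in Sym$ be symmetric functions of degree at most some positive integer $n$. If $f[\Xi_\mu]=g[\Xi_\mu]$ for all partitions $\mu$ with $|\mu|\le n$, then $f=g$ in $Sym$.
   Context: $Sym=\mathbb{Q}[p_1,p_2,\dots]$ is the ring of symmetric functions, with $\deg p_k=k$. For $k\ge1$, $\Xi_k$ is the multiset $1,e^{2\pi i/k},\dots,e^{2(k-1)\pi i/k}$, for a partition $\mu$ (including the empty partition) $\Xi_\mu$ is the multiset union of $\Xi_{\mu_1},\dots,\Xi_{\mu_{\ell(\mu)}}$, and $f[\Xi_\mu]$ is obtained by replacing each $p_k$ in $f$ by the sum of the $k$-th powers of the elements of $\Xi_\mu$. -}

module Defs where

open import Data.Nat as ℕ using (ℕ; _≤_)
open import Data.Nat.Divisibility using (_∣?_)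
open import Data.Integer using (+_)
open import Data.Rational using (ℚ; _/_; 0ℚ; 1ℚ; _+_; _*_)
open import Data.List using (List; []; _∷_; foldr; map)
open import Data.List.Properties using (≡-dec)
open import Data.List.Relation.Unary.All using (All)
open import Data.List.Relation.Unary.Linked using (Linked)
open import Data.Product using (_×_; _,_)
open import Relation.Nullary using (yes; no)
open import Relation.Binary.PropositionalEquality using (_≡_)

record Partition : Set where
  constructor mkPartition
  field
    parts      : List ℕ
    positive   : All (λ x → 1 ≤ x) parts
    decreasing : Linked (λ a b → b ≤ a) parts
open Partition public

size : Partition → ℕ
size μ = foldr ℕ._+_ 0 (parts μ)

sumℚ : List ℚ → ℚ
sumℚ = foldr _+_ 0ℚ

prodℚ : List ℚ → ℚ
prodℚ = foldr _*_ 1ℚ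

-- An element of Sym = ℚ[p₁,p₂,…], presented as a finite formal ℚ-linear
-- combination of the monomials p_λ = p_{λ₁} ⋯ p_{λℓ} (λ a partition).
-- Different lists may represent the same symmetric function; the
-- coefficient of p_λ is the sum of the coefficients attached to λ.
Sym : Set
Sym = List (ℚ × Partition)

coeff : Sym → Partition → ℚ
coeff [] λ′ = 0ℚ
coeff ((c , ν) ∷ f) λ′ with ≡-dec ℕ._≟_ (parts ν) (parts λ′)
... | yes _ = c + coeff f λ′
... | no  _ = coeff f λ′

-- equality in Sym ({p_λ} is a ℚ-basis of Sym)
_≈Sym_ : Sym → Sym → Set
f ≈Sym g = ∀ λ′ → coeff f λ′ ≡ coeff g λ′

-- deg f ≤ n  (deg p_λ = |λ|)
DegreeAtMost : ℕ → Sym → Set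
DegreeAtMost n f = ∀ λ′ → n ℕ.< size λ′ → coeff f λ′ ≡ 0ℚ

-- p_k[Ξ_m] = Σ_{j<m} e^{2πijk/m}, which equals m if m ∣ k and 0 otherwise.
powerSumRoots : ℕ → ℕ → ℚ
powerSumRoots m k with m ∣? k
... | yes _ = + m / 1
... | no  _ = 0ℚ

-- p_k[Ξ_μ] : sum over the parts of μ (multiset union)
pAt : Partition → ℕ → ℚ
pAt μ k = sumℚ (map (λ m → powerSumRoots m k) (parts μ))

evalAt : Sym → Partition → ℚ
evalAt f μ = sumℚ (map (λ { (c , ν) → c * prodℚ (map (pAt μ) (parts ν)) }) f)

{-# OPTIONS --safe #-}
module Submission where

-- Induction on K: a combination of p_λ with |λ| ≤ n and all parts ≤ K is determined by its
-- values at Ξ_μ for the μ in the same range.  Put L = K + 1 and write h = Σ_j p_L^j h_j with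
-- the h_j free of p_L.  Adding t parts L to μ leaves p_k[Ξ_μ] unchanged for 0 < k < L (the
-- k-th power sum of the L-th roots of unity vanishes) and raises p_L[Ξ_μ] by tL, so
-- h[Ξ_{L^t ∪ μ}] is the polynomial Σ_j h_j[Ξ_μ] x^j evaluated at x = p_L[Ξ_μ] + tL.  Going down
-- from the top j, once the higher h_i are known to vanish, this polynomial has degree ≤ j and
-- vanishes at the j + 1 distinct points t = 0, …, j (those partitions have size ≤ n when
-- |μ| ≤ n − jL), so h_j vanishes at every such Ξ_μ and h_j = 0 by induction.  The theorem is
-- the case K = n applied to f − g, truncated to its terms of size ≤ n.

open import Defs
open import Data.Nat using (ℕ; _≤_)
open import Relation.Binary.PropositionalEquality using (_≡_)

open import Data.Empty using (⊥-elim)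
import Data.Integer as ℤ
open import Data.List using (List; []; _∷_; _++_; map; length; filter; replicate)
open import Data.List.Properties using (≡-dec; length-filter; filter-reject; map-cong-local)
open import Data.List.Relation.Unary.All using (All; []; _∷_)
import Data.List.Relation.Unary.All as All
open import Data.List.Relation.Unary.All.Properties using (all-filter; replicate⁺; ++⁺)
open import Data.List.Relation.Unary.Linked using (Linked; []; [-])
import Data.List.Relation.Unary.Linked as Linked
open import Data.List.Relation.Unary.Linked.Properties using (Linked⇒All)
open import Data.Nat as ℕ using (zero; suc; z≤n; s≤s; z<s; s<s; _<_; _≥_; _∸_; _≟_)
open import Data.Nat.Divisibility using (_∣?_; ∣⇒≤; ∣-refl)
open import Data.Nat.ListAction using (sum)
import Data.Nat.Properties as ℕ
open import Data.Product using (_×_; _,_; map₁)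
open import Data.Rational using (ℚ; 0ℚ; 1ℚ; _+_; _*_; _-_; -_; _/_; 1/_; NonZero; NonNegative; ≢-nonZero; +-*-rawSemiring)
open import Data.Rational.Properties
  using ( +-0-group; +-assoc; +-comm; +-identityˡ; +-inverseʳ; neg-distrib-+; *-assoc; *-identityˡ; *-identityʳ
        ; *-zeroˡ; *-zeroʳ; *-inverseˡ; *-distribʳ-+; <-irrefl; positive⁻¹; pos⇒nonZero; normalize-pos
        ; nonNeg+nonNeg⇒nonNeg; pos+nonNeg⇒pos )
open import Algebra.Definitions.RawSemiring +-*-rawSemiring using (_^_)
open import Algebra.Properties.Group +-0-group using (∙-cancelˡ; x∙y⁻¹≈ε⇒x≈y)
open import Data.Rational.Solver using (module +-*-Solver)
open import Function using (_∘_)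
open import Relation.Binary.PropositionalEquality using (_≢_; refl; sym; trans; cong; cong₂; subst; module ≡-Reasoning)
open import Relation.Nullary using (¬_; yes; no)
open import Relation.Unary using (Decidable)
open import Relation.Unary.Properties using (∁?)

open +-*-Solver using (solve; _:=_; _:+_; _:*_; _:-_; :-_; con)

-- Polynomials over ℚ

fromℕ : ℕ → ℚ
fromℕ zero    = 0ℚ
fromℕ (suc t) = 1ℚ + fromℕ t

fromℕ-nonNeg : ∀ t → NonNegative (fromℕ t)
fromℕ-nonNeg zero    = _
fromℕ-nonNeg (suc t) = nonNeg+nonNeg⇒nonNeg 1ℚ (fromℕ t) {{fromℕ-nonNeg t}}

fromℕ-suc≢0 : ∀ t → fromℕ (suc t) ≢ 0ℚ
fromℕ-suc≢0 t eq = <-irrefl (sym eq) (positive⁻¹ (fromℕ (suc t)) {{pos+nonNeg⇒pos 1ℚ (fromℕ t) {{fromℕ-nonNeg t}}}})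

fromℕ-injective : ∀ {s t} → fromℕ s ≡ fromℕ t → s ≡ t
fromℕ-injective {zero}  {zero}  _  = refl
fromℕ-injective {zero}  {suc t} eq = ⊥-elim (fromℕ-suc≢0 t (sym eq))
fromℕ-injective {suc s} {zero}  eq = ⊥-elim (fromℕ-suc≢0 s eq)
fromℕ-injective {suc s} {suc t} eq = cong suc (fromℕ-injective (∙-cancelˡ 1ℚ (fromℕ s) (fromℕ t) eq))

x*y≡0⇒y≡0 : ∀ x y .{{_ : NonZero x}} → x * y ≡ 0ℚ → y ≡ 0ℚ
x*y≡0⇒y≡0 x y xy≡0 = begin
  y                ≡⟨ sym (*-identityˡ y) ⟩
  1ℚ * y           ≡⟨ cong (_* y) (sym (*-inverseˡ x)) ⟩
  (1/ x) * x * y   ≡⟨ *-assoc (1/ x) x y ⟩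
  (1/ x) * (x * y) ≡⟨ cong ((1/ x) *_) xy≡0 ⟩
  (1/ x) * 0ℚ      ≡⟨ *-zeroʳ (1/ x) ⟩
  0ℚ               ∎
  where open ≡-Reasoning

progression-injective : ∀ a d .{{_ : NonZero d}} {s t} → a + fromℕ s * d ≡ a + fromℕ t * d → s ≡ t
progression-injective a d {s} {t} eq =
  fromℕ-injective (x∙y⁻¹≈ε⇒x≈y (fromℕ s) (fromℕ t) (x*y≡0⇒y≡0 d (fromℕ s - fromℕ t) d[s-t]≡0))
  where
  open ≡-Reasoning
  d[s-t]≡0 : d * (fromℕ s - fromℕ t) ≡ 0ℚ
  d[s-t]≡0 = begin
    d * (fromℕ s - fromℕ t)
      ≡⟨ solve 4 (λ a d s t → d :* (s :- t) := (a :+ s :* d) :- (a :+ t :* d)) refl a d (fromℕ s) (fromℕ t) ⟩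
    (a + fromℕ s * d) - (a + fromℕ t * d) ≡⟨ cong (_- (a + fromℕ t * d)) eq ⟩
    (a + fromℕ t * d) - (a + fromℕ t * d) ≡⟨ +-inverseʳ (a + fromℕ t * d) ⟩
    0ℚ                                     ∎

horner : ℕ → (ℕ → ℚ) → ℚ → ℚ
horner zero    b x = 0ℚ
horner (suc m) b x = b 0 + x * horner m (b ∘ suc) x

horner-cong : ∀ m {b c : ℕ → ℚ} x → (∀ i → b i ≡ c i) → horner m b x ≡ horner m c x
horner-cong zero    x b≗c = refl
horner-cong (suc m) x b≗c = cong₂ (λ u v → u + x * v) (b≗c 0) (horner-cong m x (b≗c ∘ suc))

horner-zero : ∀ m {b} x → (∀ i → b i ≡ 0ℚ) → horner m b x ≡ 0ℚ
horner-zero zero    x b≡0 = refl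
horner-zero (suc m) {b} x b≡0 = begin
  b 0 + x * horner m (b ∘ suc) x ≡⟨ cong₂ (λ u v → u + x * v) (b≡0 0) (horner-zero m x (b≡0 ∘ suc)) ⟩
  0ℚ + x * 0ℚ                    ≡⟨ solve 1 (λ x → con 0ℚ :+ x :* con 0ℚ := con 0ℚ) refl x ⟩
  0ℚ                             ∎
  where open ≡-Reasoning

horner-+ : ∀ m b c x → horner m (λ i → b i + c i) x ≡ horner m b x + horner m c x
horner-+ zero    b c x = sym (+-identityˡ 0ℚ)
horner-+ (suc m) b c x = begin
  (b 0 + c 0) + x * horner m (λ i → b (suc i) + c (suc i)) x
    ≡⟨ cong (λ v → (b 0 + c 0) + x * v) (horner-+ m (b ∘ suc) (c ∘ suc) x) ⟩
  (b 0 + c 0) + x * (B + C)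
    ≡⟨ solve 5 (λ b₀ c₀ x B C → (b₀ :+ c₀) :+ x :* (B :+ C) := (b₀ :+ x :* B) :+ (c₀ :+ x :* C))
               refl (b 0) (c 0) x B C ⟩
  (b 0 + x * B) + (c 0 + x * C)
    ∎
  where
  open ≡-Reasoning
  B = horner m (b ∘ suc) x
  C = horner m (c ∘ suc) x

horner-truncate : ∀ k m b x → k ≤ m → (∀ i → k ≤ i → b i ≡ 0ℚ) → horner m b x ≡ horner k b x
horner-truncate zero    m       b x _         b≡0 = horner-zero m x (λ i → b≡0 i z≤n)
horner-truncate (suc k) (suc m) b x (s≤s k≤m) b≡0 =
  cong (λ v → b 0 + x * v) (horner-truncate k m (b ∘ suc) x k≤m (λ i k≤i → b≡0 (suc i) (s≤s k≤i)))

monomial : ℕ → ℚ → ℕ → ℚ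
monomial zero    v zero    = v
monomial zero    v (suc i) = 0ℚ
monomial (suc s) v zero    = 0ℚ
monomial (suc s) v (suc i) = monomial s v i

monomial-diagonal : ∀ s v → monomial s v s ≡ v
monomial-diagonal zero    v = refl
monomial-diagonal (suc s) v = monomial-diagonal s v

monomial-off-diagonal : ∀ s v i → s ≢ i → monomial s v i ≡ 0ℚ
monomial-off-diagonal zero    v zero    s≢i = ⊥-elim (s≢i refl)
monomial-off-diagonal zero    v (suc i) _   = refl
monomial-off-diagonal (suc s) v zero    _   = refl
monomial-off-diagonal (suc s) v (suc i) s≢i = monomial-off-diagonal s v i (s≢i ∘ cong suc)

horner-monomial : ∀ m s v x → s < m → horner m (monomial s v) x ≡ x ^ s * v
horner-monomial (suc m) zero v x _ = begin
  v + x * horner m (λ _ → 0ℚ) x ≡⟨ cong (λ u → v + x * u) (horner-zero m x (λ _ → refl)) ⟩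
  v + x * 0ℚ                    ≡⟨ solve 2 (λ v x → v :+ x :* con 0ℚ := con 1ℚ :* v) refl v x ⟩
  1ℚ * v                        ∎
  where open ≡-Reasoning
horner-monomial (suc m) (suc s) v x (s<s s<m) = begin
  0ℚ + x * horner m (monomial s v) x ≡⟨ cong (λ u → 0ℚ + x * u) (horner-monomial m s v x s<m) ⟩
  0ℚ + x * (x ^ s * v)               ≡⟨ solve 3 (λ x p v → con 0ℚ :+ x :* (p :* v) := (x :* p) :* v) refl x (x ^ s) v ⟩
  x * x ^ s * v                      ∎
  where open ≡-Reasoning

-- The coefficients of (b(x) − b(r)) / (x − r), by synthetic division.
quotient : ℕ → (ℕ → ℚ) → ℚ → ℕ → ℚ
quotient zero    b r i       = 0ℚ
quotient (suc m) b r zero    = horner m (b ∘ suc) r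
quotient (suc m) b r (suc i) = quotient m (b ∘ suc) r i

horner-quotient : ∀ m b r x → horner (suc m) b x ≡ horner (suc m) b r + (x - r) * horner m (quotient (suc m) b r) x
horner-quotient zero b r x =
  solve 3 (λ b₀ x r → b₀ :+ x :* con 0ℚ := (b₀ :+ r :* con 0ℚ) :+ (x :- r) :* con 0ℚ) refl (b 0) x r
horner-quotient (suc m) b r x = begin
  b 0 + x * horner (suc m) (b ∘ suc) x  ≡⟨ cong (λ v → b 0 + x * v) (horner-quotient m (b ∘ suc) r x) ⟩
  b 0 + x * (B + (x - r) * Q)
    ≡⟨ solve 5 (λ b₀ x r B Q → b₀ :+ x :* (B :+ (x :- r) :* Q) := (b₀ :+ r :* B) :+ (x :- r) :* (B :+ x :* Q))
               refl (b 0) x r B Q ⟩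
  (b 0 + r * B) + (x - r) * (B + x * Q) ∎
  where
  open ≡-Reasoning
  B = horner (suc m) (b ∘ suc) r
  Q = horner m (quotient (suc m) (b ∘ suc) r) x

quotient≡0⇒coefficients≡0 : ∀ m b r → horner (suc m) b r ≡ 0ℚ → (∀ i → i < m → quotient (suc m) b r i ≡ 0ℚ) →
                            ∀ i → i < suc m → b i ≡ 0ℚ
quotient≡0⇒coefficients≡0 m b r b[r]≡0 q≡0 zero _ = begin
  b 0                   ≡⟨ solve 3 (λ b₀ r B → b₀ := (b₀ :+ r :* B) :- r :* B) refl (b 0) r B ⟩
  (b 0 + r * B) - r * B ≡⟨ cong₂ (λ u v → u - r * v) b[r]≡0 (q₀≡0 m q≡0) ⟩
  0ℚ - r * 0ℚ           ≡⟨ solve 1 (λ r → con 0ℚ :- r :* con 0ℚ := con 0ℚ) refl r ⟩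
  0ℚ                    ∎
  where
  open ≡-Reasoning
  B = horner m (b ∘ suc) r
  q₀≡0 : ∀ m → (∀ i → i < m → quotient (suc m) b r i ≡ 0ℚ) → horner m (b ∘ suc) r ≡ 0ℚ
  q₀≡0 zero    _   = refl
  q₀≡0 (suc m) q≡0 = q≡0 0 z<s
quotient≡0⇒coefficients≡0 (suc m) b r _ q≡0 (suc i) (s<s i<m) =
  quotient≡0⇒coefficients≡0 m (b ∘ suc) r (q≡0 0 z<s) (λ j j<m → q≡0 (suc j) (s<s j<m)) i i<m

distinct-roots⇒coefficients≡0 : ∀ m b (p : ℕ → ℚ) → (∀ {s t} → p s ≡ p t → s ≡ t) →
                                (∀ t → t < m → horner m b (p t) ≡ 0ℚ) → ∀ i → i < m → b i ≡ 0ℚ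
distinct-roots⇒coefficients≡0 (suc m) b p p-injective roots =
  quotient≡0⇒coefficients≡0 m b (p 0) (roots 0 z<s)
    (distinct-roots⇒coefficients≡0 m q (p ∘ suc) (ℕ.suc-injective ∘ p-injective) q-roots)
  where
  q = quotient (suc m) b (p 0)
  q-roots : ∀ t → t < m → horner m q (p (suc t)) ≡ 0ℚ
  q-roots t t<m = x*y≡0⇒y≡0 gap (horner m q (p (suc t))) {{≢-nonZero gap≢0}} (begin
    gap * horner m q (p (suc t))                          ≡⟨ sym (+-identityˡ _) ⟩
    0ℚ + gap * horner m q (p (suc t))                     ≡⟨ cong (_+ gap * horner m q (p (suc t))) (sym (roots 0 z<s)) ⟩
    horner (suc m) b (p 0) + gap * horner m q (p (suc t)) ≡⟨ sym (horner-quotient m b (p 0) (p (suc t))) ⟩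
    horner (suc m) b (p (suc t))                          ≡⟨ roots (suc t) (s<s t<m) ⟩
    0ℚ                                                    ∎)
    where
    open ≡-Reasoning
    gap = p (suc t) - p 0
    gap≢0 : gap ≢ 0ℚ
    gap≢0 gap≡0 = ℕ.1+n≢0 (p-injective (x∙y⁻¹≈ε⇒x≈y _ _ gap≡0))

-- Partitions with their largest parts split off

parts≤sum : ∀ xs → All (_≤ sum xs) xs
parts≤sum []       = []
parts≤sum (x ∷ xs) = ℕ.m≤m+n x (sum xs) ∷ All.map (λ y≤ → ℕ.≤-trans y≤ (ℕ.m≤n+m (sum xs) x)) (parts≤sum xs)

sum-replicate++ : ∀ L t ys → sum (replicate t L ++ ys) ≡ t ℕ.* L ℕ.+ sum ys
sum-replicate++ L zero    ys = refl
sum-replicate++ L (suc t) ys = trans (cong (L ℕ.+_) (sum-replicate++ L t ys)) (sym (ℕ.+-assoc L (t ℕ.* L) (sum ys)))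

-- On a weakly decreasing list with all entries ≤ L, this is the multiplicity of L.
leading : ℕ → List ℕ → ℕ
leading L []       = 0
leading L (x ∷ xs) with x ≟ L
... | yes _ = suc (leading L xs)
... | no _  = 0

dropLeading : ℕ → List ℕ → List ℕ
dropLeading L []       = []
dropLeading L (x ∷ xs) with x ≟ L
... | yes _ = dropLeading L xs
... | no _  = x ∷ xs

replicate-leading++dropLeading : ∀ L xs → replicate (leading L xs) L ++ dropLeading L xs ≡ xs
replicate-leading++dropLeading L []       = refl
replicate-leading++dropLeading L (x ∷ xs) with x ≟ L
... | yes refl = cong (x ∷_) (replicate-leading++dropLeading L xs)
... | no _     = refl

leading-dropLeading-injective : ∀ L {xs ys} → leading L xs ≡ leading L ys → dropLeading L xs ≡ dropLeading L ys →
                                xs ≡ ys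
leading-dropLeading-injective L {xs} {ys} eq₁ eq₂ = begin
  xs                                             ≡⟨ sym (replicate-leading++dropLeading L xs) ⟩
  replicate (leading L xs) L ++ dropLeading L xs ≡⟨ cong₂ (λ t zs → replicate t L ++ zs) eq₁ eq₂ ⟩
  replicate (leading L ys) L ++ dropLeading L ys ≡⟨ replicate-leading++dropLeading L ys ⟩
  ys                                             ∎
  where open ≡-Reasoning

sum-leading : ∀ L xs → sum xs ≡ leading L xs ℕ.* L ℕ.+ sum (dropLeading L xs)
sum-leading L xs = trans (cong sum (sym (replicate-leading++dropLeading L xs)))
                         (sum-replicate++ L (leading L xs) (dropLeading L xs))

leading-≤-sum : ∀ K xs → leading (suc K) xs ≤ sum xs
leading-≤-sum K xs = ℕ.≤-trans (ℕ.m≤m*n s (suc K))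
  (ℕ.≤-trans (ℕ.m≤m+n (s ℕ.* suc K) _) (ℕ.≤-reflexive (sym (sum-leading (suc K) xs))))
  where s = leading (suc K) xs

dropLeading-All : ∀ {P : ℕ → Set} L {xs} → All P xs → All P (dropLeading L xs)
dropLeading-All L {[]}     []         = []
dropLeading-All L {x ∷ xs} (px ∷ pxs) with x ≟ L
... | yes _ = dropLeading-All L pxs
... | no _  = px ∷ pxs

dropLeading-Linked : ∀ {R : ℕ → ℕ → Set} L {xs} → Linked R xs → Linked R (dropLeading L xs)
dropLeading-Linked L {[]}     linked = linked
dropLeading-Linked L {x ∷ xs} linked with x ≟ L
... | yes _ = dropLeading-Linked L (Linked.tail linked)
... | no _  = linked

dropLeading-< : ∀ L xs → All (_≤ L) xs → Linked _≥_ xs → All (_< L) (dropLeading L xs)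
dropLeading-< L []       []           _      = []
dropLeading-< L (x ∷ xs) (x≤L ∷ xs≤L) sorted with x ≟ L
... | yes _  = dropLeading-< L xs xs≤L (Linked.tail sorted)
... | no x≢L = All.map (λ y≤x → ℕ.≤-<-trans y≤x (ℕ.≤∧≢⇒< x≤L x≢L))
                       (Linked⇒All (λ x≥y y≥z → ℕ.≤-trans y≥z x≥y) ℕ.≤-refl sorted)

replicate++-sorted : ∀ L t ys → All (_≤ L) ys → Linked _≥_ ys → Linked _≥_ (replicate t L ++ ys)
replicate++-sorted L zero          ys       _         sorted = sorted
replicate++-sorted L (suc zero)    []       _         _      = [-]
replicate++-sorted L (suc zero)    (y ∷ ys) (y≤L ∷ _) sorted = y≤L Linked.∷ sorted
replicate++-sorted L (suc (suc t)) ys       ys≤L      sorted =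
  ℕ.≤-refl Linked.∷ replicate++-sorted L (suc t) ys ys≤L sorted

∅ : Partition
∅ = mkPartition [] [] []

parts≤0⇒[] : ∀ ν → All (_≤ 0) (parts ν) → parts ν ≡ []
parts≤0⇒[] (mkPartition []      _        _) _         = refl
parts≤0⇒[] (mkPartition (_ ∷ _) (() ∷ _) _) (z≤n ∷ _)

dropLeadingᵖ : ℕ → Partition → Partition
dropLeadingᵖ L ν =
  mkPartition (dropLeading L (parts ν)) (dropLeading-All L (positive ν)) (dropLeading-Linked L (decreasing ν))

prepend : (K t : ℕ) (μ : Partition) → All (_≤ suc K) (parts μ) → Partition
prepend K t μ μ≤L = mkPartition (replicate t (suc K) ++ parts μ) (++⁺ (replicate⁺ t (s≤s z≤n)) (positive μ))
                                (replicate++-sorted (suc K) t (parts μ) μ≤L (decreasing μ))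

InBox : ℕ → ℕ → List ℕ → Set
InBox n K xs = sum xs ≤ n × All (_≤ K) xs

-- Formal combinations of the p_λ

coeff-here : ∀ c ν h λ′ → parts ν ≡ parts λ′ → coeff ((c , ν) ∷ h) λ′ ≡ c + coeff h λ′
coeff-here c ν h λ′ eq with ≡-dec ℕ._≟_ (parts ν) (parts λ′)
... | yes _  = refl
... | no neq = ⊥-elim (neq eq)

coeff-there : ∀ c ν h λ′ → parts ν ≢ parts λ′ → coeff ((c , ν) ∷ h) λ′ ≡ coeff h λ′
coeff-there c ν h λ′ neq with ≡-dec ℕ._≟_ (parts ν) (parts λ′)
... | yes eq = ⊥-elim (neq eq)
... | no _   = refl

SupportedIn : (List ℕ → Set) → Sym → Set
SupportedIn Q h = All (λ (_ , ν) → Q (parts ν)) h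

coeff-outside-support : ∀ {Q} h λ′ → SupportedIn Q h → ¬ Q (parts λ′) → coeff h λ′ ≡ 0ℚ
coeff-outside-support         []            λ′ []          _  = refl
coeff-outside-support {Q = Q} ((c , ν) ∷ h) λ′ (qν ∷ supp) ¬q =
  trans (coeff-there c ν h λ′ (λ eq → ¬q (subst Q eq qν))) (coeff-outside-support h λ′ supp ¬q)

module _ {Q : List ℕ → Set} (Q? : Decidable Q) where

  onParts : Decidable (λ ((_ , ν) : ℚ × Partition) → Q (parts ν))
  onParts (_ , ν) = Q? (parts ν)

  restrict : Sym → Sym
  restrict = filter onParts

  coeff-restrict-∈ : ∀ h λ′ → Q (parts λ′) → coeff (restrict h) λ′ ≡ coeff h λ′
  coeff-restrict-∈ []            λ′ q = refl
  coeff-restrict-∈ ((c , ν) ∷ h) λ′ q with Q? (parts ν) | ≡-dec ℕ._≟_ (parts ν) (parts λ′)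
  ... | yes _  | yes eq = trans (coeff-here c ν _ λ′ eq) (cong (c +_) (coeff-restrict-∈ h λ′ q))
  ... | yes _  | no neq = trans (coeff-there c ν _ λ′ neq) (coeff-restrict-∈ h λ′ q)
  ... | no ¬qν | yes eq = ⊥-elim (¬qν (subst Q (sym eq) q))
  ... | no _   | no _   = coeff-restrict-∈ h λ′ q

  coeff-restrict-∉ : ∀ h λ′ → ¬ Q (parts λ′) → coeff (restrict h) λ′ ≡ 0ℚ
  coeff-restrict-∉ h λ′ = coeff-outside-support (restrict h) λ′ (all-filter onParts h)

-- evalAt h μ is linearExtension (prodℚ ∘ map (pAt μ)) h by definition.
linearExtension : (List ℕ → ℚ) → Sym → ℚ
linearExtension w h = sumℚ (map (λ (c , ν) → c * w (parts ν)) h)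

linearExtension-split : ∀ {Q} (Q? : Decidable Q) w h →
                        linearExtension w h ≡
                        linearExtension w (restrict Q? h) + linearExtension w (restrict (∁? Q?) h)
linearExtension-split Q? w []            = sym (+-identityˡ 0ℚ)
linearExtension-split Q? w ((c , ν) ∷ h) with Q? (parts ν)
... | yes _ = trans (cong (a +_) (linearExtension-split Q? w h)) (sym (+-assoc a B C))
  where
  a = c * w (parts ν)
  B = linearExtension w (restrict Q? h)
  C = linearExtension w (restrict (∁? Q?) h)
... | no _  = trans (cong (a +_) (linearExtension-split Q? w h))
                    (solve 3 (λ a B C → a :+ (B :+ C) := B :+ (a :+ C)) refl a B C)
  where
  a = c * w (parts ν)
  B = linearExtension w (restrict Q? h)
  C = linearExtension w (restrict (∁? Q?) h)

linearExtension-homogeneous : ∀ w ν h → SupportedIn (_≡ parts ν) h → linearExtension w h ≡ coeff h ν * w (parts ν)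
linearExtension-homogeneous w ν []             []          = sym (*-zeroˡ (w (parts ν)))
linearExtension-homogeneous w ν ((c , ν′) ∷ h) (eq ∷ supp) = begin
  c * w (parts ν′) + linearExtension w h    ≡⟨ cong₂ (λ xs v → c * w xs + v) eq (linearExtension-homogeneous w ν h supp) ⟩
  c * w (parts ν) + coeff h ν * w (parts ν) ≡⟨ sym (*-distribʳ-+ (w (parts ν)) c (coeff h ν)) ⟩
  (c + coeff h ν) * w (parts ν)             ≡⟨ cong (_* w (parts ν)) (sym (coeff-here c ν′ h ν eq)) ⟩
  coeff ((c , ν′) ∷ h) ν * w (parts ν)      ∎
  where open ≡-Reasoning

-- The terms sharing the partition of the first term contribute (their total coefficient) · w = 0;
-- the other terms form a shorter combination with zero coefficients.
linearExtension-≈[] : ∀ w h → h ≈Sym [] → linearExtension w h ≡ 0ℚ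
linearExtension-≈[] w h = go (length h) h ℕ.≤-refl
  where
  go : ∀ N h → length h ≤ N → h ≈Sym [] → linearExtension w h ≡ 0ℚ
  go N       []                 _         _   = refl
  go (suc N) h@((c , ν) ∷ h′) (s≤s len) h≈0 = begin
    linearExtension w h                                        ≡⟨ linearExtension-split Q? w h ⟩
    linearExtension w (restrict Q? h) + linearExtension w rest
      ≡⟨ cong₂ _+_ (linearExtension-homogeneous w ν _ (all-filter (onParts Q?) h)) (go N rest shorter rest≈0) ⟩
    coeff (restrict Q? h) ν * w (parts ν) + 0ℚ
      ≡⟨ cong (λ a → a * w (parts ν) + 0ℚ) (trans (coeff-restrict-∈ Q? h ν refl) (h≈0 ν)) ⟩
    0ℚ * w (parts ν) + 0ℚ
      ≡⟨ solve 1 (λ a → con 0ℚ :* a :+ con 0ℚ := con 0ℚ) refl (w (parts ν)) ⟩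
    0ℚ                                                         ∎
    where
    open ≡-Reasoning
    Q? : Decidable (_≡ parts ν)
    Q? xs = ≡-dec ℕ._≟_ xs (parts ν)
    rest = restrict (∁? Q?) h
    shorter : length rest ≤ N
    shorter = subst (λ hs → length hs ≤ N) (sym (filter-reject (onParts (∁? Q?)) (λ ¬eq → ¬eq refl)))
                    (ℕ.≤-trans (length-filter (onParts (∁? Q?)) h′) len)
    rest≈0 : rest ≈Sym []
    rest≈0 λ′ with Q? (parts λ′)
    ... | yes eq = coeff-restrict-∉ (∁? Q?) h λ′ (λ ¬eq → ¬eq eq)
    ... | no ¬eq = trans (coeff-restrict-∈ (∁? Q?) h λ′ ¬eq) (h≈0 λ′)

negate : Sym → Sym
negate = map (map₁ (λ c → - c))

_⊖_ : Sym → Sym → Sym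
f ⊖ g = f ++ negate g

coeff-++ : ∀ f g λ′ → coeff (f ++ g) λ′ ≡ coeff f λ′ + coeff g λ′
coeff-++ []            g λ′ = sym (+-identityˡ (coeff g λ′))
coeff-++ ((c , ν) ∷ f) g λ′ with ≡-dec ℕ._≟_ (parts ν) (parts λ′)
... | yes _ = trans (cong (c +_) (coeff-++ f g λ′)) (sym (+-assoc c (coeff f λ′) (coeff g λ′)))
... | no _  = coeff-++ f g λ′

coeff-negate : ∀ g λ′ → coeff (negate g) λ′ ≡ - coeff g λ′
coeff-negate []            λ′ = refl
coeff-negate ((c , ν) ∷ g) λ′ with ≡-dec ℕ._≟_ (parts ν) (parts λ′)
... | yes _ = trans (cong (- c +_) (coeff-negate g λ′)) (sym (neg-distrib-+ c (coeff g λ′)))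
... | no _  = coeff-negate g λ′

coeff-⊖ : ∀ f g λ′ → coeff (f ⊖ g) λ′ ≡ coeff f λ′ - coeff g λ′
coeff-⊖ f g λ′ = trans (coeff-++ f (negate g) λ′) (cong (coeff f λ′ +_) (coeff-negate g λ′))

linearExtension-++ : ∀ w f g → linearExtension w (f ++ g) ≡ linearExtension w f + linearExtension w g
linearExtension-++ w []            g = sym (+-identityˡ (linearExtension w g))
linearExtension-++ w ((c , ν) ∷ f) g = trans (cong (c * w (parts ν) +_) (linearExtension-++ w f g))
  (sym (+-assoc (c * w (parts ν)) (linearExtension w f) (linearExtension w g)))

linearExtension-negate : ∀ w g → linearExtension w (negate g) ≡ - linearExtension w g
linearExtension-negate w []            = refl
linearExtension-negate w ((c , ν) ∷ g) = trans (cong (- c * w (parts ν) +_) (linearExtension-negate w g))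
  (solve 3 (λ c x a → (:- c) :* x :+ (:- a) := :- (c :* x :+ a)) refl c (w (parts ν)) (linearExtension w g))

linearExtension-⊖ : ∀ w f g → linearExtension w (f ⊖ g) ≡ linearExtension w f - linearExtension w g
linearExtension-⊖ w f g = trans (linearExtension-++ w f (negate g)) (cong (linearExtension w f +_) (linearExtension-negate w g))

⊖≈[]⇒≈ : ∀ f g → (f ⊖ g) ≈Sym [] → f ≈Sym g
⊖≈[]⇒≈ f g f⊖g≈0 λ′ =
  x∙y⁻¹≈ε⇒x≈y (coeff f λ′) (coeff g λ′) (trans (sym (coeff-⊖ f g λ′)) (f⊖g≈0 λ′))

⊖-degree : ∀ n f g → DegreeAtMost n f → DegreeAtMost n g → DegreeAtMost n (f ⊖ g)
⊖-degree n f g deg-f deg-g λ′ n<|λ| = begin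
  coeff (f ⊖ g) λ′        ≡⟨ coeff-⊖ f g λ′ ⟩
  coeff f λ′ - coeff g λ′ ≡⟨ cong₂ _-_ (deg-f λ′ n<|λ|) (deg-g λ′ n<|λ|) ⟩
  0ℚ - 0ℚ                 ≡⟨ +-inverseʳ 0ℚ ⟩
  0ℚ                      ∎
  where open ≡-Reasoning

linearExtension-cong : ∀ w {f g} → f ≈Sym g → linearExtension w f ≡ linearExtension w g
linearExtension-cong w {f} {g} f≈g = x∙y⁻¹≈ε⇒x≈y (linearExtension w f) (linearExtension w g) (begin
  linearExtension w f - linearExtension w g ≡⟨ sym (linearExtension-⊖ w f g) ⟩
  linearExtension w (f ⊖ g)                 ≡⟨ linearExtension-≈[] w (f ⊖ g) f⊖g≈0 ⟩
  0ℚ                                        ∎)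
  where
  open ≡-Reasoning
  f⊖g≈0 : (f ⊖ g) ≈Sym []
  f⊖g≈0 λ′ = trans (coeff-⊖ f g λ′) (trans (cong (_- coeff g λ′) (f≈g λ′)) (+-inverseʳ (coeff g λ′)))

evalAt-≈[] : ∀ h → h ≈Sym [] → ∀ μ → evalAt h μ ≡ 0ℚ
evalAt-≈[] h h≈0 μ = linearExtension-≈[] (prodℚ ∘ map (pAt μ)) h h≈0

evalAt-cong : ∀ {f g} → f ≈Sym g → ∀ μ → evalAt f μ ≡ evalAt g μ
evalAt-cong {f} {g} f≈g μ = linearExtension-cong (prodℚ ∘ map (pAt μ)) {f} {g} f≈g

-- f ⊖ g may have terms of size > n whose coefficients cancel; dropping them makes the
-- degree bound visible on every term.
truncate : ℕ → Sym → Sym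
truncate n = restrict (λ xs → sum xs ℕ.≤? n)

truncate-≈ : ∀ n h → DegreeAtMost n h → truncate n h ≈Sym h
truncate-≈ n h deg λ′ with sum (parts λ′) ℕ.≤? n
... | yes |λ|≤n = coeff-restrict-∈ (λ xs → sum xs ℕ.≤? n) h λ′ |λ|≤n
... | no  |λ|≰n = trans (coeff-restrict-∉ (λ xs → sum xs ℕ.≤? n) h λ′ |λ|≰n) (sym (deg λ′ (ℕ.≰⇒> |λ|≰n)))

truncate-supported : ∀ n h → SupportedIn (InBox n n) (truncate n h)
truncate-supported n h =
  All.map (λ {(_ , ν)} |ν|≤n → |ν|≤n , All.map (λ k≤ → ℕ.≤-trans k≤ |ν|≤n) (parts≤sum (parts ν)))
          (all-filter (onParts (λ xs → sum xs ℕ.≤? n)) h)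

-- Power sums at Ξ_{L^t ∪ μ}, and the layers of a combination

sumℚ-replicate++ : ∀ (g : ℕ → ℚ) L t ys → sumℚ (map g (replicate t L ++ ys)) ≡ fromℕ t * g L + sumℚ (map g ys)
sumℚ-replicate++ g L zero    ys = solve 2 (λ a b → b := con 0ℚ :* a :+ b) refl (g L) (sumℚ (map g ys))
sumℚ-replicate++ g L (suc t) ys = trans (cong (g L +_) (sumℚ-replicate++ g L t ys))
  (solve 3 (λ a t b → a :+ (t :* a :+ b) := (con 1ℚ :+ t) :* a :+ b) refl (g L) (fromℕ t) (sumℚ (map g ys)))

prodℚ-replicate++ : ∀ (g : ℕ → ℚ) L s ys → prodℚ (map g (replicate s L ++ ys)) ≡ g L ^ s * prodℚ (map g ys)
prodℚ-replicate++ g L zero    ys = sym (*-identityˡ (prodℚ (map g ys)))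
prodℚ-replicate++ g L (suc s) ys = trans (cong (g L *_) (prodℚ-replicate++ g L s ys))
  (sym (*-assoc (g L) (g L ^ s) (prodℚ (map g ys))))

powerSumRoots-self : ∀ m → powerSumRoots m m ≡ ℤ.+ m / 1
powerSumRoots-self m with m ∣? m
... | yes _  = refl
... | no m∤m = ⊥-elim (m∤m ∣-refl)

powerSumRoots-< : ∀ m k → 1 ≤ k → k < m → powerSumRoots m k ≡ 0ℚ
powerSumRoots-< m k 1≤k k<m with m ∣? k
... | yes m∣k = ⊥-elim (ℕ.<⇒≱ k<m (∣⇒≤ {{ℕ.>-nonZero 1≤k}} m∣k))
... | no _    = refl

pAt-prepend : ∀ K t μ μ≤L k → pAt (prepend K t μ μ≤L) k ≡ fromℕ t * powerSumRoots (suc K) k + pAt μ k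
pAt-prepend K t μ μ≤L k = sumℚ-replicate++ (λ m → powerSumRoots m k) (suc K) t (parts μ)

module _ (K : ℕ) where

  -- Adding one part L = suc K to μ raises p_L[Ξ_μ] by this amount.
  spacing : ℚ
  spacing = ℤ.+ suc K / 1

  spacing-nonZero : NonZero spacing
  spacing-nonZero = pos⇒nonZero spacing {{normalize-pos (suc K) 1}}

  pAt-prepend-< : ∀ t μ μ≤L k → 1 ≤ k → k ≤ K → pAt (prepend K t μ μ≤L) k ≡ pAt μ k
  pAt-prepend-< t μ μ≤L k 1≤k k≤K = begin
    pAt (prepend K t μ μ≤L) k                   ≡⟨ pAt-prepend K t μ μ≤L k ⟩
    fromℕ t * powerSumRoots (suc K) k + pAt μ k
      ≡⟨ cong (λ p → fromℕ t * p + pAt μ k) (powerSumRoots-< (suc K) k 1≤k (s≤s k≤K)) ⟩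
    fromℕ t * 0ℚ + pAt μ k                      ≡⟨ solve 2 (λ t p → t :* con 0ℚ :+ p := p) refl (fromℕ t) (pAt μ k) ⟩
    pAt μ k                                     ∎
    where open ≡-Reasoning

  pAt-prepend-top : ∀ t μ μ≤L → pAt (prepend K t μ μ≤L) (suc K) ≡ pAt μ (suc K) + fromℕ t * spacing
  pAt-prepend-top t μ μ≤L = trans (pAt-prepend K t μ μ≤L (suc K))
    (trans (cong (λ p → fromℕ t * p + pAt μ (suc K)) (powerSumRoots-self (suc K)))
           (+-comm (fromℕ t * spacing) (pAt μ (suc K))))

  prodℚ-pAt-prepend : ∀ t μ μ≤L ν → All (_≤ suc K) (parts ν) →
                      prodℚ (map (pAt (prepend K t μ μ≤L)) (parts ν)) ≡
                      (pAt μ (suc K) + fromℕ t * spacing) ^ leading (suc K) (parts ν) *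
                      prodℚ (map (pAt μ) (dropLeading (suc K) (parts ν)))
  prodℚ-pAt-prepend t μ μ≤L ν ν≤L = begin
    prodℚ (map p′ (parts ν))
      ≡⟨ cong (prodℚ ∘ map p′) (sym (replicate-leading++dropLeading (suc K) (parts ν))) ⟩
    prodℚ (map p′ (replicate s (suc K) ++ rest))
      ≡⟨ prodℚ-replicate++ p′ (suc K) s rest ⟩
    p′ (suc K) ^ s * prodℚ (map p′ rest)
      ≡⟨ cong₂ (λ x ps → x ^ s * prodℚ ps) (pAt-prepend-top t μ μ≤L) (map-cong-local unchanged) ⟩
    (pAt μ (suc K) + fromℕ t * spacing) ^ s * prodℚ (map (pAt μ) rest) ∎
    where
    open ≡-Reasoning
    p′ = pAt (prepend K t μ μ≤L)
    s = leading (suc K) (parts ν)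
    rest = dropLeading (suc K) (parts ν)
    unchanged : All (λ k → p′ k ≡ pAt μ k) rest
    unchanged = All.zipWith (λ (1≤k , k<L) → pAt-prepend-< t μ μ≤L _ 1≤k (ℕ.≤-pred k<L))
                            (dropLeading-All (suc K) (positive ν) , dropLeading-< (suc K) (parts ν) ν≤L (decreasing ν))

-- When every part of h is ≤ L, h = Σ_j p_L^j · layer L j h.
layer : ℕ → ℕ → Sym → Sym
layer L j []            = []
layer L j ((c , ν) ∷ h) with leading L (parts ν) ≟ j
... | yes _ = (c , dropLeadingᵖ L ν) ∷ layer L j h
... | no _  = layer L j h

coeff-layer : ∀ L h λ′ → coeff h λ′ ≡ coeff (layer L (leading L (parts λ′)) h) (dropLeadingᵖ L λ′)
coeff-layer L []            λ′ = refl
coeff-layer L ((c , ν) ∷ h) λ′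
  with ≡-dec ℕ._≟_ (parts ν) (parts λ′) | leading L (parts ν) ≟ leading L (parts λ′)
... | yes eq | no neqₗ = ⊥-elim (neqₗ (cong (leading L) eq))
... | yes eq | yes _   = trans (cong (c +_) (coeff-layer L h λ′))
  (sym (coeff-here c (dropLeadingᵖ L ν) _ (dropLeadingᵖ L λ′) (cong (dropLeading L) eq)))
... | no neq | yes eqₗ = trans (coeff-layer L h λ′)
  (sym (coeff-there c (dropLeadingᵖ L ν) _ (dropLeadingᵖ L λ′) (neq ∘ leading-dropLeading-injective L eqₗ)))
... | no _   | no _    = coeff-layer L h λ′

layer-supported : ∀ L j n h → SupportedIn (InBox n L) h →
                  SupportedIn (λ xs → j ℕ.* L ℕ.+ sum xs ≤ n × All (_< L) xs) (layer L j h)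
layer-supported L j n []            []                    = []
layer-supported L j n ((c , ν) ∷ h) ((|ν|≤n , ν≤L) ∷ supp) with leading L (parts ν) ≟ j
... | yes refl = (subst (_≤ n) (sum-leading L (parts ν)) |ν|≤n , dropLeading-< L (parts ν) ν≤L (decreasing ν))
                 ∷ layer-supported L j n h supp
... | no _     = layer-supported L j n h supp

evalAt-layer-∷ : ∀ L i c ν h μ →
                 evalAt (layer L i ((c , ν) ∷ h)) μ ≡
                 monomial (leading L (parts ν)) (c * prodℚ (map (pAt μ) (dropLeading L (parts ν)))) i +
                 evalAt (layer L i h) μ
evalAt-layer-∷ L i c ν h μ with leading L (parts ν) ≟ i
... | yes refl = cong (_+ evalAt (layer L i h) μ) (sym (monomial-diagonal i _))
... | no s≢i   = trans (sym (+-identityˡ _))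
                       (cong (_+ evalAt (layer L i h) μ) (sym (monomial-off-diagonal _ _ i s≢i)))

evalAt-prepend : ∀ K n h → SupportedIn (InBox n (suc K)) h → ∀ t μ μ≤L →
                 evalAt h (prepend K t μ μ≤L) ≡
                 horner (suc n) (λ j → evalAt (layer (suc K) j h) μ) (pAt μ (suc K) + fromℕ t * spacing K)
evalAt-prepend K n []            []                    t μ μ≤L =
  sym (horner-zero (suc n) (pAt μ (suc K) + fromℕ t * spacing K) (λ _ → refl))
evalAt-prepend K n ((c , ν) ∷ h) ((|ν|≤n , ν≤L) ∷ supp) t μ μ≤L = begin
  c * prodℚ (map (pAt (prepend K t μ μ≤L)) (parts ν)) + evalAt h (prepend K t μ μ≤L)
    ≡⟨ cong₂ (λ p e → c * p + e) (prodℚ-pAt-prepend K t μ μ≤L ν ν≤L) (evalAt-prepend K n h supp t μ μ≤L) ⟩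
  c * (x ^ s * P) + E
    ≡⟨ cong (_+ E) (solve 3 (λ c y P → c :* (y :* P) := y :* (c :* P)) refl c (x ^ s) P) ⟩
  x ^ s * (c * P) + E
    ≡⟨ cong (_+ E) (sym (horner-monomial (suc n) s (c * P) x (s≤s (ℕ.≤-trans (leading-≤-sum K (parts ν)) |ν|≤n)))) ⟩
  horner (suc n) (monomial s (c * P)) x + E
    ≡⟨ sym (horner-+ (suc n) (monomial s (c * P)) (λ j → evalAt (layer L j h) μ) x) ⟩
  horner (suc n) (λ j → monomial s (c * P) j + evalAt (layer L j h) μ) x
    ≡⟨ sym (horner-cong (suc n) x (λ j → evalAt-layer-∷ L j c ν h μ)) ⟩
  horner (suc n) (λ j → evalAt (layer L j ((c , ν) ∷ h)) μ) x
    ∎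
  where
  open ≡-Reasoning
  L = suc K
  x = pAt μ L + fromℕ t * spacing K
  s = leading L (parts ν)
  P = prodℚ (map (pAt μ) (dropLeading L (parts ν)))
  E = horner (suc n) (λ j → evalAt (layer L j h) μ) x

-- Unisolvence

m+n≤o⇒n≤o∸m : ∀ m {n o} → m ℕ.+ n ≤ o → n ≤ o ∸ m
m+n≤o⇒n≤o∸m m {n} m+n≤o = subst (_≤ _ ∸ m) (ℕ.m+n∸m≡n m n) (ℕ.∸-monoˡ-≤ m m+n≤o)

downward-induction : ∀ {p} {P : ℕ → Set p} N → (∀ j → N < j → P j) →
                     (∀ j → (∀ i → j < i → P i) → P j) → ∀ j → P j
downward-induction {P = P} N beyond step j = go (suc N) j (ℕ.m≤n+m (suc N) j)
  where
  go : ∀ d j → N < j ℕ.+ d → P j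
  go zero    j N<j+0   = beyond j (subst (N <_) (ℕ.+-identityʳ j) N<j+0)
  go (suc d) j N<j+1+d = step j λ i j<i →
    go d i (ℕ.≤-trans (subst (N <_) (ℕ.+-suc j d) N<j+1+d) (ℕ.+-monoˡ-≤ d j<i))

VanishesOn : (List ℕ → Set) → Sym → Set
VanishesOn Q h = ∀ μ → Q (parts μ) → evalAt h μ ≡ 0ℚ

Unisolvent : ℕ → Set
Unisolvent K = ∀ n h → SupportedIn (InBox n K) h → VanishesOn (InBox n K) h → h ≈Sym []

layer-vanishes : ∀ K n h → SupportedIn (InBox n (suc K)) h → VanishesOn (InBox n (suc K)) h →
                 ∀ j → j ℕ.* suc K ≤ n → (∀ i → j < i → layer (suc K) i h ≈Sym []) →
                 VanishesOn (InBox (n ∸ j ℕ.* suc K) K) (layer (suc K) j h)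
layer-vanishes K n h supp vanish j jL≤n higher μ (|μ|≤ , μ≤K) =
  distinct-roots⇒coefficients≡0 (suc j) b p p-injective roots j ℕ.≤-refl
  where
  open ≡-Reasoning
  L = suc K
  b : ℕ → ℚ
  b i = evalAt (layer L i h) μ
  p : ℕ → ℚ
  p t = pAt μ L + fromℕ t * spacing K
  p-injective : ∀ {s t} → p s ≡ p t → s ≡ t
  p-injective = progression-injective (pAt μ L) (spacing K) {{spacing-nonZero K}}
  μ≤L : All (_≤ L) (parts μ)
  μ≤L = All.map ℕ.m≤n⇒m≤1+n μ≤K
  roots : ∀ t → t < suc j → horner (suc j) b (p t) ≡ 0ℚ
  roots t t≤j = begin
    horner (suc j) b (p t)
      ≡⟨ sym (horner-truncate (suc j) (suc n) b (p t) (s≤s (ℕ.≤-trans (ℕ.m≤m*n j L) jL≤n))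
                              (λ i j<i → evalAt-≈[] (layer L i h) (higher i j<i) μ)) ⟩
    horner (suc n) b (p t)        ≡⟨ sym (evalAt-prepend K n h supp t μ μ≤L) ⟩
    evalAt h (prepend K t μ μ≤L)  ≡⟨ vanish (prepend K t μ μ≤L) (|prepend|≤n , ++⁺ (replicate⁺ t ℕ.≤-refl) μ≤L) ⟩
    0ℚ                            ∎
    where
    |prepend|≤n : sum (replicate t L ++ parts μ) ≤ n
    |prepend|≤n = ℕ.≤-trans (ℕ.≤-reflexive (sum-replicate++ L t (parts μ)))
      (ℕ.≤-trans (ℕ.+-mono-≤ (ℕ.*-monoˡ-≤ L (ℕ.≤-pred t≤j)) |μ|≤) (ℕ.≤-reflexive (ℕ.m+[n∸m]≡n jL≤n)))

only-∅ : ∀ {n} h → SupportedIn (InBox n 0) h → SupportedIn (_≡ []) h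
only-∅ h = All.map (λ {(_ , ν)} (_ , ν≤0) → parts≤0⇒[] ν ν≤0)

unisolvent-0 : Unisolvent 0
unisolvent-0 n h supp vanish λ′@(mkPartition [] _ _) = begin
  coeff h λ′      ≡⟨ sym (*-identityʳ (coeff h λ′)) ⟩
  coeff h λ′ * 1ℚ ≡⟨ sym (linearExtension-homogeneous (prodℚ ∘ map (pAt ∅)) λ′ h (only-∅ h supp)) ⟩
  evalAt h ∅      ≡⟨ vanish ∅ (z≤n , []) ⟩
  0ℚ              ∎
  where open ≡-Reasoning
unisolvent-0 n h supp vanish λ′@(mkPartition (_ ∷ _) _ _) = coeff-outside-support h λ′ (only-∅ h supp) (λ ())

unisolvent-suc : ∀ K → Unisolvent K → Unisolvent (suc K)
unisolvent-suc K unisolvent-K n h supp vanish λ′ =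
  trans (coeff-layer L h λ′)
        (downward-induction n layer-beyond layer-below (leading L (parts λ′)) (dropLeadingᵖ L λ′))
  where
  L = suc K
  layer-empty : ∀ j → n < j ℕ.* L → layer L j h ≈Sym []
  layer-empty j n<jL λ″ = coeff-outside-support (layer L j h) λ″ (layer-supported L j n h supp)
    (λ (≤n , _) → ℕ.<⇒≱ n<jL (ℕ.≤-trans (ℕ.m≤m+n (j ℕ.* L) _) ≤n))
  layer-beyond : ∀ j → n < j → layer L j h ≈Sym []
  layer-beyond j n<j = layer-empty j (ℕ.<-≤-trans n<j (ℕ.m≤m*n j L))
  layer-below : ∀ j → (∀ i → j < i → layer L i h ≈Sym []) → layer L j h ≈Sym []
  layer-below j higher with j ℕ.* L ℕ.≤? n
  ... | no  jL≰n = layer-empty j (ℕ.≰⇒> jL≰n)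
  ... | yes jL≤n = unisolvent-K (n ∸ j ℕ.* L) (layer L j h)
    (All.map (λ (≤n , <L) → m+n≤o⇒n≤o∸m (j ℕ.* L) ≤n , All.map ℕ.≤-pred <L) (layer-supported L j n h supp))
    (layer-vanishes K n h supp vanish j jL≤n higher)

unisolvent : ∀ K → Unisolvent K
unisolvent zero    = unisolvent-0
unisolvent (suc K) = unisolvent-suc K (unisolvent K)

proposition54 : (n : ℕ) → 1 ≤ n → (f g : Sym) →
    DegreeAtMost n f → DegreeAtMost n g →
    ((μ : Partition) → size μ ≤ n → evalAt f μ ≡ evalAt g μ) →
    f ≈Sym g
proposition54 n _ f g deg-f deg-g agree = ⊖≈[]⇒≈ f g (λ λ′ → trans (sym (d≈f⊖g λ′)) (d≈[] λ′))
  where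
  open ≡-Reasoning
  d : Sym
  d = truncate n (f ⊖ g)
  d≈f⊖g : d ≈Sym (f ⊖ g)
  d≈f⊖g = truncate-≈ n (f ⊖ g) (⊖-degree n f g deg-f deg-g)
  d-vanishes : VanishesOn (InBox n n) d
  d-vanishes μ (|μ|≤n , _) = begin
    evalAt d μ              ≡⟨ evalAt-cong {d} {f ⊖ g} d≈f⊖g μ ⟩
    evalAt (f ⊖ g) μ        ≡⟨ linearExtension-⊖ (prodℚ ∘ map (pAt μ)) f g ⟩
    evalAt f μ - evalAt g μ ≡⟨ cong (_- evalAt g μ) (agree μ |μ|≤n) ⟩
    evalAt g μ - evalAt g μ ≡⟨ +-inverseʳ (evalAt g μ) ⟩
    0ℚ                      ∎
  d≈[] : d ≈Sym []
  d≈[] = unisolvent n n d (truncate-supported n (f ⊖ g)) d-vanishes
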